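{- Let $\mathbf c\in\mathbb Z_{\ge1}^n$, let $P=(x_1^{c_1+1},\dots,x_n^{c_n+1})\subset S$, and let $I\subset S$ be a $\mathbf c$-ideal. Then $$\mathrm{pol}(P):\mathrm{pol}(I+P)=\mathrm{pol}^*(I^\vee+P)$$ in $\widetilde S$, where $J:L=\{f\in\widetilde S: fL\subset J\}$.
   Context: Let $K$ be a field, $\mathbf c=(c_1,\dots,c_n)\in\mathbb Z_{\ge1}^n$, $\overline{\mathbf c}=(c_1+1,\dots,c_n+1)$, $S=K[x_1,\dots,x_n]$, $x^{\mathbf a}=x_1^{a_1}\cdots x_n^{a_n}$. A $\mathbf c$-monomial (resp. $\overline{\mathbf c}$-monomial) is $x^{\mathbf a}$ with $a_i\le c_i$ (resp. $a_i\le c_i+1$) for all $i$; a $\mathbf c$-ideal ($\overline{\mathbf c}$-ideal) is a monomial ideal generated by $\mathbf c$-monomials ($\overline{\mathbf c}$-monomials). The Alexander dual of a $\mathbf c$-ideal $I$ w.r.t. $\mathbf c$ is $I^\vee=(x_1^{c_1-a_1}\cdots x_n^{c_n-a_n}:x^{\mathbf a}\text{ a }\mathbf c\text{ -monomial},\ x^{\mathbf a}\notin I)\subset S$. Let $\widetilde S=K[x_{i,j}:1\le i\le n,0\le j\le c_i]$. For a $\overline{\mathbf c}$-monomial $x^{\mathbf a}$: $\mathrm{pol}(x^{\mathbf a})=\prod_{a_i\ne0}x_{i,0}x_{i,1}\cdots x_{i,a_i-1}$ and $\mathrm{pol}^*(x^{\mathbf a})=\prod_{a_i\ne0}x_{i,c_i}x_{i,c_i-1}\cdots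 x_{i,c_i-a_i+1}$; for a $\overline{\mathbf c}$-ideal $J$ with minimal monomial generating set $G(J)$, $\mathrm{pol}(J)=(\mathrm{pol}(u):u\in G(J))$ and $\mathrm{pol}^*(J)=(\mathrm{pol}^*(u):u\in G(J))$, ideals of $\widetilde S$. -}

module Defs where

open import Level using (Level; _⊔_)
open import Algebra.Bundles using (CommutativeRing)
open import Data.Nat using (ℕ; zero; suc; _≤_; _<_; _<?_; _∸_)
import Data.Nat as ℕ
open import Data.Fin using (Fin; toℕ)
import Data.Fin as F
open import Data.Fin.Properties using (all?)
open import Data.Bool using (if_then_else_)
open import Data.List using (List; []; _∷_; _++_; map; concatMap; concat; [_])
open import Data.List.Relation.Unary.All using (All)
open import Data.Product using (Σ; _×_; _,_; proj₁; proj₂; ∃)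
open import Relation.Nullary using (Dec; yes; no; ¬_; does)
open import Relation.Binary.PropositionalEquality using (_≡_)

IsField : ∀ {a ℓ} → CommutativeRing a ℓ → Set (a ⊔ ℓ)
IsField K = (¬ (1# ≈ 0#)) × (∀ x → ¬ (x ≈ 0#) → Σ Carrier λ y → x * y ≈ 1#)
  where open CommutativeRing K

-- A polynomial is a finite list of terms
-- (coefficient, monomial); two polynomials are equal iff all coefficients agree.
module Poly {a ℓ} (K : CommutativeRing a ℓ) (M : Set) (_·_ : M → M → M)
            (_≈M_ : M → M → Set) (_≟M_ : ∀ u v → Dec (u ≈M v)) where
  open CommutativeRing K renaming (Carrier to A)

  Pol : Set a
  Pol = List (A × M)

  coeff : Pol → M → A
  coeff [] m = 0#
  coeff ((x , u) ∷ p) m with u ≟M m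
  ... | yes _ = x + coeff p m
  ... | no _ = coeff p m

  _≈P_ : Pol → Pol → Set ℓ
  p ≈P q = ∀ m → coeff p m ≈ coeff q m

  _+P_ : Pol → Pol → Pol
  p +P q = p ++ q

  _*P_ : Pol → Pol → Pol
  p *P q = concatMap (λ t → map (λ s → (proj₁ t * proj₁ s , proj₂ t · proj₂ s)) q) p

  sumP : List Pol → Pol
  sumP = concat

  mono : M → Pol
  mono u = [ (1# , u) ]

  ⟨_⟩ : ∀ {p} → (Pol → Set p) → Pol → Set (a ⊔ ℓ ⊔ p)
  ⟨ G ⟩ f = Σ (List (Pol × Pol)) λ ps →
              All (λ hg → G (proj₂ hg)) ps
              × f ≈P sumP (map (λ hg → proj₁ hg *P proj₂ hg) ps)

  _∔_ : ∀ {p q} → (Pol → Set p) → (Pol → Set q) → Pol → Set (a ⊔ ℓ ⊔ p ⊔ q)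
  (J ∔ L) f = Σ Pol λ g → Σ Pol λ h → J g × L h × f ≈P (g +P h)

  _∶_ : ∀ {p q} → (Pol → Set p) → (Pol → Set q) → Pol → Set (a ⊔ p ⊔ q)
  (J ∶ L) f = ∀ l → L l → J (f *P l)

  _≐_ : ∀ {p q} → (Pol → Set p) → (Pol → Set q) → Set (a ⊔ p ⊔ q)
  J ≐ L = ∀ f → (J f → L f) × (L f → J f)

module Setup {a ℓ} (K : CommutativeRing a ℓ) (n : ℕ) (c : Fin n → ℕ) where

  -- exponent vectors of S = K[x_1..x_n]
  ExpS : Set
  ExpS = Fin n → ℕ

  _·S_ : ExpS → ExpS → ExpS
  (u ·S v) i = u i ℕ.+ v i

  _≈S_ : ExpS → ExpS → Set
  u ≈S v = ∀ i → u i ≡ v i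

  _≟S_ : ∀ u v → Dec (u ≈S v)
  u ≟S v = all? (λ i → u i ℕ.≟ v i)

  -- exponent vectors of S~ = K[x_{i,j} : i < n, 0 ≤ j ≤ c_i]
  ExpT : Set
  ExpT = (i : Fin n) → Fin (suc (c i)) → ℕ

  _·T_ : ExpT → ExpT → ExpT
  (u ·T v) i j = u i j ℕ.+ v i j

  _≈T_ : ExpT → ExpT → Set
  u ≈T v = ∀ i j → u i j ≡ v i j

  _≟T_ : ∀ u v → Dec (u ≈T v)
  u ≟T v = all? (λ i → all? (λ j → u i j ℕ.≟ v i j))

  module S = Poly K ExpS _·S_ _≈S_ _≟S_
  module T = Poly K ExpT _·T_ _≈T_ _≟T_

  IsCMon : ExpS → Set
  IsCMon e = ∀ i → e i ≤ c i

  idealOf : List ExpS → S.Pol → Set (a ⊔ ℓ)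
  idealOf gens = S.⟨ (λ g → Σ ExpS λ u → Data.List.Relation.Unary.Any.Any (λ v → u ≡ v) gens × g ≡ S.mono u) ⟩
    where import Data.List.Relation.Unary.Any

  powE : Fin n → ExpS
  powE i j with i F.≟ j
  ... | yes _ = suc (c i)
  ... | no _ = 0

  P : S.Pol → Set (a ⊔ ℓ)
  P = S.⟨ (λ g → Σ (Fin n) λ i → g ≡ S.mono (powE i)) ⟩

  dual : ∀ {p} → (S.Pol → Set p) → S.Pol → Set (a ⊔ ℓ ⊔ p)
  dual J = S.⟨ (λ g → Σ ExpS λ e → IsCMon e × (¬ J (S.mono e)) × g ≡ S.mono (λ i → c i ∸ e i)) ⟩

  MinGen : ∀ {p} → (S.Pol → Set p) → ExpS → Set p
  MinGen J u = J (S.mono u) × (∀ w → J (S.mono w) → (∀ i → w i ≤ u i) → ∀ i → w i ≡ u i)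

  -- pol(x^u) = ∏_i x_{i,0} ... x_{i,u_i - 1}
  polE : ExpS → ExpT
  polE u i j = if does (toℕ j <? u i) then 1 else 0

  -- pol*(x^u) = ∏_i x_{i,c_i} ... x_{i,c_i - u_i + 1}
  polStarE : ExpS → ExpT
  polStarE u i j = if does (c i <? toℕ j ℕ.+ u i) then 1 else 0

  pol : ∀ {p} → (S.Pol → Set p) → T.Pol → Set (a ⊔ ℓ ⊔ p)
  pol J = T.⟨ (λ g → Σ ExpS λ u → MinGen J u × g ≡ T.mono (polE u)) ⟩

  pol* : ∀ {p} → (S.Pol → Set p) → T.Pol → Set (a ⊔ ℓ ⊔ p)
  pol* J = T.⟨ (λ g → Σ ExpS λ u → MinGen J u × g ≡ T.mono (polStarE u)) ⟩

module Submission where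

-- All ideals involved are monomial ideals, and a polynomial lies in a monomial ideal iff every
-- monomial of its support is a multiple of a generator.
--
-- Then
--   pol*(J₂) ⊆ pol(P) : pol(J₁):  for x^u ∈ J₂ and x^v ∈ J₁ we have u_i + v_i > c_i for some i
--       (otherwise v ≤ c - u, contradicting x^{c-u} ∉ I), so pol*(x^u) · pol(x^v) contains row i;
--   pol(P) : pol(J₁) ⊆ pol*(J₂):  if f · pol(J₁) ⊆ pol(P) and t lies outside pol*(J₂), then some
--       minimal generator x^v of J₁ lies below c - (top run lengths of t), t · pol(x^v) has no full
--       row, and hence the coefficient of t in f, which is that of t · pol(x^v) in f · pol(x^v),
--       vanishes.

open import Defs
open import Level using (Level)
open import Algebra.Bundles using (CommutativeRing)
open import Data.Nat using (ℕ; _≤_)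
open import Data.Fin using (Fin)
open import Data.List using (List)
open import Data.List.Relation.Unary.All using (All)
open import Data.Product using (_,_)
open import Relation.Unary using (Decidable)
open import Relation.Nullary using (Dec)
open import Relation.Binary.Structures using (IsEquivalence)

module MonomialIdeals {a ℓ} (K : CommutativeRing a ℓ) {M : Set} (_·_ : M → M → M)
  (_≈M_ : M → M → Set) (_≟M_ : ∀ u v → Dec (u ≈M v)) (≈M-isEquivalence : IsEquivalence _≈M_) where

  open import Level using (_⊔_)
  open import Function using (_∘_)
  open import Data.Empty using (⊥-elim)
  open import Data.Product using (Σ; _×_; proj₁; proj₂)
  open import Data.Sum using (_⊎_; inj₁; inj₂)
  open import Data.List using ([]; _∷_; _++_; map; concat; filter)
  open import Data.List.Properties using (map-++; concat-++)
  open import Data.List.Relation.Unary.All using ([]; _∷_)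
  open import Data.List.Relation.Unary.All.Properties using (++⁺)
  open import Relation.Nullary using (yes; no; ¬_)
  open import Relation.Binary.PropositionalEquality using (_≡_; cong)
  import Relation.Binary.PropositionalEquality as ≡
  import Algebra.Properties.CommutativeSemigroup as CommSemigroupProps

  open CommutativeRing K renaming (Carrier to A)
  open Poly K M _·_ _≈M_ _≟M_
  open IsEquivalence ≈M-isEquivalence renaming (refl to ≈M-refl; sym to ≈M-sym; trans to ≈M-trans)
  open import Relation.Binary.Reasoning.Setoid setoid

  _∣_ : M → M → Set
  e ∣ t = Σ M λ w → (w · e) ≈M t

  MonomialGens : ∀ {p} → (Pol → Set p) → Set (a ⊔ p)
  MonomialGens G = ∀ g → G g → Σ M λ e → g ≡ mono e

  Covered : ∀ {p} → (Pol → Set p) → M → Set p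
  Covered G t = Σ M λ e → G (mono e) × e ∣ t

  SupportedIn : ∀ {p q} → (Pol → Set p) → (M → Set q) → Set (a ⊔ ℓ ⊔ p ⊔ q)
  SupportedIn J Q = ∀ {f} → J f → ∀ t → ¬ Q t → coeff f t ≈ 0#

  record Describes {p q} (J : Pol → Set p) (Q : M → Set q) : Set (a ⊔ ℓ ⊔ p ⊔ q) where
    field
      support : SupportedIn J Q
      contains : ∀ t → Q t → J (mono t)

  mono-injective : ∀ {u v} → mono u ≡ mono v → u ≡ v
  mono-injective ≡.refl = ≡.refl

  coeff-++ : ∀ p q t → coeff (p ++ q) t ≈ coeff p t + coeff q t
  coeff-++ [] q t = sym (+-identityˡ _)
  coeff-++ ((x , u) ∷ p) q t with u ≟M t
  ... | yes _ = trans (+-congˡ (coeff-++ p q t)) (sym (+-assoc _ _ _))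
  ... | no _ = coeff-++ p q t

  coeff-mono-self : ∀ t → coeff (mono t) t ≈ 1#
  coeff-mono-self t with t ≟M t
  ... | yes _ = +-identityʳ 1#
  ... | no t≉t = ⊥-elim (t≉t ≈M-refl)

  coeff-single-cong : ∀ {x y u v} t → x ≈ y → u ≈M v → coeff ((x , u) ∷ []) t ≈ coeff ((y , v) ∷ []) t
  coeff-single-cong {u = u} {v} t x≈y u≈v with u ≟M t | v ≟M t
  ... | yes _ | yes _ = +-congʳ x≈y
  ... | yes u≈t | no v≉t = ⊥-elim (v≉t (≈M-trans (≈M-sym u≈v) u≈t))
  ... | no u≉t | yes v≈t = ⊥-elim (u≉t (≈M-trans u≈v v≈t))
  ... | no _ | no _ = refl

  prod : Pol × Pol → Pol
  prod hg = proj₁ hg *P proj₂ hg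

  module _ {p} {G : Pol → Set p} where

    ideal-[] : ⟨ G ⟩ []
    ideal-[] = [] , [] , λ _ → refl

    ideal-++ : ∀ {f g} → ⟨ G ⟩ f → ⟨ G ⟩ g → ⟨ G ⟩ (f ++ g)
    ideal-++ {f} {g} (ps , Gps , f≈) (qs , Gqs , g≈) = ps ++ qs , ++⁺ Gps Gqs , λ t → begin
      coeff (f ++ g) t                                       ≈⟨ coeff-++ f g t ⟩
      coeff f t + coeff g t                                  ≈⟨ +-cong (f≈ t) (g≈ t) ⟩
      coeff (sumP (map prod ps)) t + coeff (sumP (map prod qs)) t
                                                             ≈⟨ sym (coeff-++ (sumP (map prod ps)) _ t) ⟩
      coeff (sumP (map prod ps) ++ sumP (map prod qs)) t     ≡⟨ cong (λ r → coeff r t) sums-++ ⟩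
      coeff (sumP (map prod (ps ++ qs))) t                   ∎
      where
      sums-++ : sumP (map prod ps) ++ sumP (map prod qs) ≡ sumP (map prod (ps ++ qs))
      sums-++ = ≡.trans (concat-++ (map prod ps) (map prod qs)) (cong concat (≡.sym (map-++ prod ps qs)))

    ideal-term : ∀ {e m} → G (mono e) → e ∣ m → ∀ x → ⟨ G ⟩ ((x , m) ∷ [])
    ideal-term {e} Ge (w , we≈m) x =
      ((x , w) ∷ [] , mono e) ∷ [] , Ge ∷ [] , λ t → coeff-single-cong t (sym (*-identityʳ x)) (≈M-sym we≈m)

    generated-supported : MonomialGens G → SupportedIn ⟨ G ⟩ (Covered G)
    generated-supported monoG (ps , Gps , f≈) t uncovered = trans (f≈ t) (sum-vanishes ps Gps)
      where
      multiple-vanishes : ∀ {e} → ¬ e ∣ t → ∀ h → coeff (h *P mono e) t ≈ 0#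
      multiple-vanishes e∤t [] = refl
      multiple-vanishes {e} e∤t ((x , u) ∷ h) with (u · e) ≟M t
      ... | yes ue≈t = ⊥-elim (e∤t (u , ue≈t))
      ... | no _ = multiple-vanishes e∤t h

      sum-vanishes : ∀ ps → All (G ∘ proj₂) ps → coeff (sumP (map prod ps)) t ≈ 0#
      sum-vanishes [] [] = refl
      sum-vanishes ((h , g) ∷ ps) (Gg ∷ Gps) with monoG g Gg
      ... | e , ≡.refl = begin
        coeff (h *P mono e ++ sumP (map prod ps)) t              ≈⟨ coeff-++ (h *P mono e) _ t ⟩
        coeff (h *P mono e) t + coeff (sumP (map prod ps)) t     ≈⟨ +-cong (multiple-vanishes e∤t h) (sum-vanishes ps Gps) ⟩
        0# + 0#                                                  ≈⟨ +-identityʳ 0# ⟩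
        0#                                                       ∎
        where e∤t = λ e∣t → uncovered (e , Gg , e∣t)

    module _ {q} {Q : M → Set q} (Q? : Decidable Q) (Q-resp : ∀ {u v} → u ≈M v → Q u → Q v)
             (Q⊆Covered : ∀ t → Q t → Covered G t) where

      inQ : Pol → Pol
      inQ = filter (λ s → Q? (proj₂ s))

      inQ-member : ∀ f → ⟨ G ⟩ (inQ f)
      inQ-member [] = ideal-[]
      inQ-member ((x , m) ∷ f) with Q? m
      ... | yes Qm = let (e , Ge , e∣m) = Q⊆Covered m Qm in
        ideal-++ {(x , m) ∷ []} {inQ f} (ideal-term {e} Ge e∣m x) (inQ-member f)
      ... | no _ = inQ-member f

      coeff-inQ-in : ∀ f t → Q t → coeff (inQ f) t ≈ coeff f t
      coeff-inQ-in [] t Qt = refl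
      coeff-inQ-in ((x , m) ∷ f) t Qt with Q? m
      ... | yes _ with m ≟M t
      ...   | yes _ = +-congˡ (coeff-inQ-in f t Qt)
      ...   | no _ = coeff-inQ-in f t Qt
      coeff-inQ-in ((x , m) ∷ f) t Qt | no ¬Qm with m ≟M t
      ...   | yes m≈t = ⊥-elim (¬Qm (Q-resp (≈M-sym m≈t) Qt))
      ...   | no _ = coeff-inQ-in f t Qt

      coeff-inQ-out : ∀ f t → ¬ Q t → coeff (inQ f) t ≈ 0#
      coeff-inQ-out [] t ¬Qt = refl
      coeff-inQ-out ((x , m) ∷ f) t ¬Qt with Q? m
      ... | no _ = coeff-inQ-out f t ¬Qt
      ... | yes Qm with m ≟M t
      ...   | yes m≈t = ⊥-elim (¬Qt (Q-resp m≈t Qm))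
      ...   | no _ = coeff-inQ-out f t ¬Qt

      support-member : ∀ f → (∀ t → ¬ Q t → coeff f t ≈ 0#) → ⟨ G ⟩ f
      support-member f vanish = ideal-resp (inQ-member f)
        where
        f≈inQ : ∀ t → coeff (inQ f) t ≈ coeff f t
        f≈inQ t with Q? t
        ... | yes Qt = coeff-inQ-in f t Qt
        ... | no ¬Qt = trans (coeff-inQ-out f t ¬Qt) (sym (vanish t ¬Qt))
        ideal-resp : ⟨ G ⟩ (inQ f) → ⟨ G ⟩ f
        ideal-resp (ps , Gps , eq) = ps , Gps , λ t → trans (sym (f≈inQ t)) (eq t)

    generated-describes : ∀ {q} {Q : M → Set q} → MonomialGens G →
      (∀ t → Covered G t → Q t) → (∀ t → Q t → Covered G t) → Describes ⟨ G ⟩ Q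
    generated-describes monoG Covered⊆Q Q⊆Covered = record
      { support = λ {f} Jf t ¬Qt → generated-supported monoG {f} Jf t (¬Qt ∘ Covered⊆Q t)
      ; contains = λ t Qt → let (e , Ge , e∣t) = Q⊆Covered t Qt in ideal-term {e} Ge e∣t 1#
      }

  ∔-describes : ∀ {p p' q q'} {J : Pol → Set p} {L : Pol → Set p'} {Q : M → Set q} {R : M → Set q'} →
    Describes J Q → Describes L R → J [] → L [] → Describes (J ∔ L) (λ t → Q t ⊎ R t)
  ∔-describes {J = J} {L} {Q} {R} dJ dL J0 L0 = record { support = λ {f} → sum-support {f} ; contains = sum-contains }
    where
    sum-support : SupportedIn (J ∔ L) (λ t → Q t ⊎ R t)
    sum-support {f} (g , h , Jg , Lh , f≈) t ¬QR = begin
      coeff f t              ≈⟨ f≈ t ⟩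
      coeff (g ++ h) t       ≈⟨ coeff-++ g h t ⟩
      coeff g t + coeff h t  ≈⟨ +-cong (Describes.support dJ Jg t (¬QR ∘ inj₁)) (Describes.support dL Lh t (¬QR ∘ inj₂)) ⟩
      0# + 0#                ≈⟨ +-identityʳ 0# ⟩
      0#                     ∎
    sum-contains : ∀ t → Q t ⊎ R t → (J ∔ L) (mono t)
    sum-contains t (inj₁ Qt) = mono t , [] , Describes.contains dJ t Qt , L0 , λ _ → refl
    sum-contains t (inj₂ Rt) = [] , mono t , J0 , Describes.contains dL t Rt , λ _ → refl

  describes-mono : ¬ (1# ≈ 0#) → ∀ {p q} {J : Pol → Set p} {Q : M → Set q} → Describes J Q →
    ∀ {t} → J (mono t) → ¬ ¬ Q t
  describes-mono 1≉0 dJ {t} Jt ¬Qt = 1≉0 (trans (sym (coeff-mono-self t)) (Describes.support dJ Jt t ¬Qt))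

  module Products
    (·-comm : ∀ u v → (u · v) ≈M (v · u))
    (·-assoc : ∀ u v w → ((u · v) · w) ≈M (u · (v · w)))
    (·-congʳ : ∀ {u v} w → u ≈M v → (u · w) ≈M (v · w))
    (·-cancelʳ : ∀ {u v} w → (u · w) ≈M (v · w) → u ≈M v)
    (_∣?_ : ∀ e t → Dec (e ∣ t))
    where

    shift : M → Pol → Pol
    shift v = map (λ s → (proj₁ s , proj₂ s · v))

    coeff-shift-∣ : ∀ f {v w t} → (w · v) ≈M t → coeff (shift v f) t ≈ coeff f w
    coeff-shift-∣ [] _ = refl
    coeff-shift-∣ ((x , u) ∷ f) {v} {w} {t} wv≈t with (u · v) ≟M t | u ≟M w
    ... | yes _ | yes _ = +-congˡ (coeff-shift-∣ f wv≈t)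
    ... | yes uv≈t | no u≉w = ⊥-elim (u≉w (·-cancelʳ v (≈M-trans uv≈t (≈M-sym wv≈t))))
    ... | no uv≉t | yes u≈w = ⊥-elim (uv≉t (≈M-trans (·-congʳ v u≈w) wv≈t))
    ... | no _ | no _ = coeff-shift-∣ f wv≈t

    coeff-shift-∤ : ∀ f {v t} → ¬ v ∣ t → coeff (shift v f) t ≈ 0#
    coeff-shift-∤ [] _ = refl
    coeff-shift-∤ ((x , u) ∷ f) {v} {t} v∤t with (u · v) ≟M t
    ... | yes uv≈t = ⊥-elim (v∤t (u , uv≈t))
    ... | no _ = coeff-shift-∤ f v∤t

    coeff-scale : ∀ x u q t →
      coeff (map (λ r → (x * proj₁ r , u · proj₂ r)) q) t ≈ x * coeff (shift u q) t
    coeff-scale x u [] t = sym (zeroʳ x)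
    coeff-scale x u ((y , v) ∷ q) t with (u · v) ≟M t | (v · u) ≟M t
    ... | yes _ | yes _ = trans (+-congˡ (coeff-scale x u q t)) (sym (distribˡ x y _))
    ... | yes uv≈t | no vu≉t = ⊥-elim (vu≉t (≈M-trans (·-comm v u) uv≈t))
    ... | no uv≉t | yes vu≈t = ⊥-elim (uv≉t (≈M-trans (·-comm u v) vu≈t))
    ... | no _ | no _ = coeff-scale x u q t

    *P-congʳ : ∀ f {q q'} → q ≈P q' → (f *P q) ≈P (f *P q')
    *P-congʳ [] q≈q' t = refl
    *P-congʳ ((x , u) ∷ f) {q} {q'} q≈q' t = begin
      coeff (map _ q ++ (f *P q)) t                   ≈⟨ coeff-++ (map _ q) (f *P q) t ⟩
      coeff (map _ q) t + coeff (f *P q) t            ≈⟨ +-cong (coeff-scale x u q t) (*P-congʳ f q≈q' t) ⟩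
      x * coeff (shift u q) t + coeff (f *P q') t     ≈⟨ +-congʳ (*-congˡ shifted) ⟩
      x * coeff (shift u q') t + coeff (f *P q') t    ≈⟨ +-congʳ (sym (coeff-scale x u q' t)) ⟩
      coeff (map _ q') t + coeff (f *P q') t          ≈⟨ sym (coeff-++ (map _ q') (f *P q') t) ⟩
      coeff (map _ q' ++ (f *P q')) t                 ∎
      where
      shifted : coeff (shift u q) t ≈ coeff (shift u q') t
      shifted with u ∣? t
      ... | yes (w , wu≈t) = trans (coeff-shift-∣ q wu≈t) (trans (q≈q' w) (sym (coeff-shift-∣ q' wu≈t)))
      ... | no u∤t = trans (coeff-shift-∤ q u∤t) (sym (coeff-shift-∤ q' u∤t))

    open CommSemigroupProps +-commutativeSemigroup using (interchange)

    *P-++ʳ : ∀ f q q' t → coeff (f *P (q ++ q')) t ≈ coeff (f *P q) t + coeff (f *P q') t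
    *P-++ʳ [] q q' t = sym (+-identityʳ 0#)
    *P-++ʳ ((x , u) ∷ f) q q' t = begin
      coeff (term (q ++ q') ++ (f *P (q ++ q'))) t                     ≈⟨ coeff-++ (term (q ++ q')) _ t ⟩
      coeff (term (q ++ q')) t + coeff (f *P (q ++ q')) t              ≡⟨ cong (λ r → coeff r t + _) (map-++ _ q q') ⟩
      coeff (term q ++ term q') t + coeff (f *P (q ++ q')) t           ≈⟨ +-cong (coeff-++ (term q) (term q') t) (*P-++ʳ f q q' t) ⟩
      (coeff (term q) t + coeff (term q') t) + (coeff (f *P q) t + coeff (f *P q') t)
                                                                       ≈⟨ interchange _ _ _ _ ⟩
      (coeff (term q) t + coeff (f *P q) t) + (coeff (term q') t + coeff (f *P q') t)
                                                                       ≈⟨ sym (+-cong (coeff-++ (term q) _ t) (coeff-++ (term q') _ t)) ⟩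
      coeff (term q ++ (f *P q)) t + coeff (term q' ++ (f *P q')) t    ∎
      where
      term : Pol → Pol
      term = map (λ r → (x * proj₁ r , u · proj₂ r))

    coeff-*[] : ∀ f t → coeff (f *P []) t ≈ 0#
    coeff-*[] [] t = refl
    coeff-*[] (_ ∷ f) t = coeff-*[] f t

    coeff-*term : ∀ f y v t → coeff (f *P ((y , v) ∷ [])) t ≈ coeff (shift v f) t * y
    coeff-*term [] y v t = sym (zeroˡ y)
    coeff-*term ((x , u) ∷ f) y v t with (u · v) ≟M t
    ... | yes _ = trans (+-congˡ (coeff-*term f y v t)) (sym (distribʳ y x _))
    ... | no _ = coeff-*term f y v t

    coeff-*mono : ∀ f e t → coeff (f *P mono e) (t · e) ≈ coeff f t
    coeff-*mono f e t = trans (coeff-*term f 1# e (t · e)) (trans (*-identityʳ _) (coeff-shift-∣ f ≈M-refl))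

    product-supported : ∀ {p q} {H : Pol → Set p} {Q : M → Set q} → MonomialGens H →
      ∀ f → (∀ w → ¬ Q w → coeff f w ≈ 0#) → ∀ {l} → ⟨ H ⟩ l →
      ∀ t → (∀ w e → Q w → H (mono e) → ¬ (w · e) ∣ t) → coeff (f *P l) t ≈ 0#
    product-supported {H = H} monoH f f-supp {l} (ps , Hps , l≈) t far =
      trans (*P-congʳ f l≈ t) (sum-vanishes ps Hps)
      where
      -- each term u of h contributes the coefficient of f at t / (u·e)
      multiple-vanishes : ∀ {e} → H (mono e) → ∀ h → coeff (f *P (h *P mono e)) t ≈ 0#
      multiple-vanishes He [] = coeff-*[] f t
      multiple-vanishes {e} He ((x , u) ∷ h) = begin
        coeff (f *P ((x * 1# , u · e) ∷ (h *P mono e))) t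
            ≈⟨ *P-++ʳ f ((x * 1# , u · e) ∷ []) (h *P mono e) t ⟩
        coeff (f *P ((x * 1# , u · e) ∷ [])) t + coeff (f *P (h *P mono e)) t
            ≈⟨ +-cong (coeff-*term f (x * 1#) (u · e) t) (multiple-vanishes He h) ⟩
        coeff (shift (u · e) f) t * (x * 1#) + 0#
            ≈⟨ +-congʳ (trans (*-congʳ shifted) (zeroˡ _)) ⟩
        0# + 0#
            ≈⟨ +-identityʳ 0# ⟩
        0#  ∎
        where
        -- if w·(u·e) = t then w·e divides t, so w lies outside Q
        shifted : coeff (shift (u · e) f) t ≈ 0#
        shifted with (u · e) ∣? t
        ... | no ue∤t = coeff-shift-∤ f ue∤t
        ... | yes (w , wue≈t) = trans (coeff-shift-∣ f wue≈t) (f-supp w λ Qw → far w e Qw He (u , we∣t))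
          where
          we∣t : (u · (w · e)) ≈M t
          we∣t = ≈M-trans (≈M-sym (·-assoc u w e))
                 (≈M-trans (·-congʳ e (·-comm u w)) (≈M-trans (·-assoc w u e) wue≈t))

      sum-vanishes : ∀ ps → All (H ∘ proj₂) ps → coeff (f *P sumP (map prod ps)) t ≈ 0#
      sum-vanishes [] [] = coeff-*[] f t
      sum-vanishes ((h , g) ∷ ps) (Hg ∷ Hps) with monoH g Hg
      ... | e , ≡.refl = begin
        coeff (f *P (h *P mono e ++ sumP (map prod ps))) t
            ≈⟨ *P-++ʳ f (h *P mono e) _ t ⟩
        coeff (f *P (h *P mono e)) t + coeff (f *P sumP (map prod ps)) t
            ≈⟨ +-cong (multiple-vanishes Hg h) (sum-vanishes ps Hps) ⟩
        0# + 0#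
            ≈⟨ +-identityʳ 0# ⟩
        0#  ∎

module Minimization where

  open import Data.Nat using (zero; suc; _<_; _+_; z≤n; s≤s; pred)
  open import Data.Nat.Properties
  open import Data.Fin using (zero; suc)
  open import Data.Fin.Properties using (any?)
  open import Data.Product using (Σ; _×_)
  open import Data.Empty using (⊥-elim)
  open import Relation.Nullary using (yes; no)
  open import Relation.Nullary.Decidable using (_×-dec_)
  open import Relation.Binary.PropositionalEquality using (_≡_)

  -- the pointwise order, i.e. divisibility of monomials of S
  _≤V_ : ∀ {n} → (Fin n → ℕ) → (Fin n → ℕ) → Set
  u ≤V v = ∀ i → u i ≤ v i

  lowerAt : ∀ {n} → Fin n → (Fin n → ℕ) → Fin n → ℕ
  lowerAt zero w zero = pred (w zero)
  lowerAt zero w (suc j) = w (suc j)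
  lowerAt (suc i) w zero = w zero
  lowerAt (suc i) w (suc j) = lowerAt i (λ k → w (suc k)) j

  total : ∀ {n} → (Fin n → ℕ) → ℕ
  total {zero} w = 0
  total {suc n} w = w zero + total (λ k → w (suc k))

  lowerAt-≤ : ∀ {n} (i : Fin n) w j → lowerAt i w j ≤ w j
  lowerAt-≤ zero w zero = pred[n]≤n
  lowerAt-≤ zero w (suc j) = ≤-refl
  lowerAt-≤ (suc i) w zero = ≤-refl
  lowerAt-≤ (suc i) w (suc j) = lowerAt-≤ i _ j

  lowerAt-below : ∀ {n} (i : Fin n) (w w' : Fin n → ℕ) → w' ≤V w → w' i < w i → w' ≤V lowerAt i w
  lowerAt-below zero w w' le lt zero with w zero | lt
  ... | suc _ | s≤s lt' = lt'
  lowerAt-below zero w w' le lt (suc j) = le (suc j)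
  lowerAt-below (suc i) w w' le lt zero = le zero
  lowerAt-below (suc i) w w' le lt (suc j) = lowerAt-below i _ _ (λ k → le (suc k)) lt j

  lowerAt-total : ∀ {n} (i : Fin n) w → 0 < w i → total (lowerAt i w) < total w
  lowerAt-total zero w lt with w zero | lt
  ... | suc _ | _ = ≤-refl
  lowerAt-total (suc i) w lt = begin-strict
    w zero + total (lowerAt i (λ k → w (suc k)))  <⟨ +-monoʳ-< (w zero) (lowerAt-total i _ lt) ⟩
    w zero + total (λ k → w (suc k))              ∎
    where open ≤-Reasoning

  module _ {n} (Q : (Fin n → ℕ) → Set) (Q? : Decidable Q) (Q-up : ∀ {u v} → u ≤V v → Q u → Q v) where

    Minimal : (Fin n → ℕ) → Set
    Minimal u = Q u × (∀ w → Q w → w ≤V u → ∀ i → w i ≡ u i)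

    -- if no single decrement stays in Q, w is minimal; otherwise descend, with total w as measure
    minimal-below : ∀ w → Q w → Σ (Fin n → ℕ) λ u → u ≤V w × Minimal u
    minimal-below w = descend (total w) w ≤-refl
      where
      descend : ∀ k w → total w ≤ k → Q w → Σ (Fin n → ℕ) λ u → u ≤V w × Minimal u
      descend k w bound Qw with any? (λ i → (1 ≤? w i) ×-dec Q? (lowerAt i w))
      descend zero w bound Qw | yes (i , pos , Qlow) = ⊥-elim (n≮0 (<-≤-trans (lowerAt-total i w pos) bound))
      descend (suc k) w bound Qw | yes (i , pos , Qlow)
        with descend k (lowerAt i w) (≤-pred (<-≤-trans (lowerAt-total i w pos) bound)) Qlow
      ... | u , u≤ , minU = u , (λ j → ≤-trans (u≤ j) (lowerAt-≤ i w j)) , minU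
      descend k w bound Qw | no stuck = w , (λ _ → ≤-refl) , Qw , minimal
        where
        minimal : ∀ w' → Q w' → w' ≤V w → ∀ i → w' i ≡ w i
        minimal w' Qw' le i with w' i ≟ w i
        ... | yes eq = eq
        ... | no neq = ⊥-elim (stuck (i , <-≤-trans (s≤s z≤n) lt , Q-up (lowerAt-below i w w' le lt) Qw'))
          where lt = ≤∧≢⇒< (le i) neq

module Largest (P : ℕ → Set) (P? : Decidable P) where

  open import Data.Nat using (zero; suc; z≤n)
  open import Data.Nat.Properties
  open import Data.Sum using (inj₁; inj₂)
  open import Data.Empty using (⊥-elim)
  open import Relation.Nullary using (yes; no)
  open import Relation.Binary.PropositionalEquality using (refl)

  largest : ℕ → ℕ
  largest zero = zero
  largest (suc m) with P? (suc m)
  ... | yes _ = suc m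
  ... | no _ = largest m

  largest-sat : P 0 → ∀ m → P (largest m)
  largest-sat P0 zero = P0
  largest-sat P0 (suc m) with P? (suc m)
  ... | yes Pm = Pm
  ... | no _ = largest-sat P0 m

  largest-≤ : ∀ m → largest m ≤ m
  largest-≤ zero = z≤n
  largest-≤ (suc m) with P? (suc m)
  ... | yes _ = ≤-refl
  ... | no _ = m≤n⇒m≤1+n (largest-≤ m)

  largest-max : ∀ m k → k ≤ m → P k → k ≤ largest m
  largest-max m zero _ _ = z≤n
  largest-max (suc m) (suc k) k≤m Pk with P? (suc m)
  ... | yes _ = k≤m
  ... | no ¬Pm with m≤n⇒m<n∨m≡n k≤m
  ...   | inj₁ k<m = largest-max m (suc k) (≤-pred k<m) Pk
  ...   | inj₂ refl = ⊥-elim (¬Pm Pk)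

module Lemma5p2 {a ℓ} (K : CommutativeRing a ℓ) (isField : IsField K) (n : ℕ) (c : Fin n → ℕ)
                (gens : List (Fin n → ℕ)) where

  open import Level using (_⊔_)
  open import Data.Nat using (suc; _<_; _≤?_; _<?_; _∸_; _+_; z≤n; s≤s)
  open import Data.Nat.Properties
  open import Data.Fin using (toℕ)
  import Data.Fin as F
  open import Data.Fin.Properties using (any?; all?; ¬∀⟶∃¬; toℕ<n)
  open import Data.List.Relation.Unary.Any using (Any)
  import Data.List.Relation.Unary.Any as Any
  open import Data.List.Membership.Propositional using (find)
  open import Data.Product using (Σ; _×_; proj₁)
  open import Data.Sum using (_⊎_; inj₁; inj₂)
  open import Data.Empty using (⊥-elim)
  open import Data.Bool using (if_then_else_)
  open import Relation.Nullary using (yes; no; ¬_; does)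
  open import Relation.Nullary.Decidable using (_⊎-dec_; _→-dec_; ¬?; decidable-stable; dec-true; dec-false)
  open import Relation.Binary.PropositionalEquality using (_≡_; refl; sym; trans; cong; cong₂; subst)
  open import Function using (_∘_)
  open Minimization

  open Setup K n c
  module KR = CommutativeRing K

  -- the only property of the field K that is used
  1≉0 : ¬ (KR.1# KR.≈ KR.0#)
  1≉0 = proj₁ isField

  ≈S-isEquivalence : IsEquivalence _≈S_
  ≈S-isEquivalence = record
    { refl = λ _ → refl ; sym = λ u≈v i → sym (u≈v i) ; trans = λ u≈v v≈w i → trans (u≈v i) (v≈w i) }

  module MS = MonomialIdeals K _·S_ _≈S_ _≟S_ ≈S-isEquivalence
  open MS using (Describes; ideal-[]; generated-describes; ∔-describes; describes-mono; mono-injective)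

  ∣⇒≤S : ∀ {e t} → e MS.∣ t → e ≤V t
  ∣⇒≤S {e} (w , we≈t) i = subst (e i ≤_) (we≈t i) (m≤n+m (e i) (w i))

  ≤S⇒∣ : ∀ {e t} → e ≤V t → e MS.∣ t
  ≤S⇒∣ {e} {t} e≤t = (λ i → t i ∸ e i) , λ i → m∸n+n≡m (e≤t i)

  mono-member : ∀ {p q} {J : S.Pol → Set p} {Q : ExpS → Set q} → Describes J Q → Decidable Q →
    ∀ {w} → J (S.mono w) → Q w
  mono-member dJ Q? {w} Jw = decidable-stable (Q? w) (describes-mono 1≉0 dJ Jw)

  minimal-generator : ∀ {p} {J : S.Pol → Set p} {Q : ExpS → Set} → Describes J Q → Decidable Q →
    (∀ {u v} → u ≤V v → Q u → Q v) → ∀ {w} → Q w → Σ ExpS λ u → u ≤V w × MinGen J u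
  minimal-generator {Q = Q} dJ Q? Q-up {w} Qw with minimal-below Q Q? Q-up w Qw
  ... | u , u≤w , Qu , minimal =
    u , u≤w , Describes.contains dJ u Qu , λ w' Jw' w'≤u → minimal w' (mono-member dJ Q? Jw') w'≤u

  IGen : S.Pol → Set a
  IGen g = Σ ExpS λ u → Any (λ v → u ≡ v) gens × g ≡ S.mono u

  I : S.Pol → Set (a ⊔ ℓ)
  I = idealOf gens

  InI : ExpS → Set
  InI w = Any (_≤V w) gens

  InI? : Decidable InI
  InI? w = Any.any? (λ g → all? (λ i → g i ≤? w i)) gens

  I-describes : Describes I InI
  I-describes = generated-describes (λ { g (u , _ , g≡) → u , g≡ }) covered⇒InI InI⇒covered
    where
    covered⇒InI : ∀ w → MS.Covered IGen w → InI w
    covered⇒InI w (e , (u , u∈gens , e≡u) , e∣w) with mono-injective e≡u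
    ... | refl = Any.map (λ { refl → ∣⇒≤S e∣w }) u∈gens
    InI⇒covered : ∀ w → InI w → MS.Covered IGen w
    InI⇒covered w InIw with find InIw
    ... | u , u∈gens , u≤w = u , (u , u∈gens , refl) , ≤S⇒∣ u≤w

  powE-self : ∀ i → powE i i ≡ suc (c i)
  powE-self i with i F.≟ i
  ... | yes _ = refl
  ... | no i≢i = ⊥-elim (i≢i refl)

  powE-support : ∀ {i j} → 0 < powE i j → i ≡ j
  powE-support {i} {j} pos with i F.≟ j
  ... | yes i≡j = i≡j
  ... | no _ = ⊥-elim (n≮0 pos)

  PGen : S.Pol → Set a
  PGen g = Σ (Fin n) λ i → g ≡ S.mono (powE i)

  InP : ExpS → Set
  InP w = Σ (Fin n) λ i → suc (c i) ≤ w i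

  InP? : Decidable InP
  InP? w = any? (λ i → suc (c i) ≤? w i)

  powE-≤ : ∀ {i w} → suc (c i) ≤ w i → powE i ≤V w
  powE-≤ {i} le j with i F.≟ j
  ... | yes refl = le
  ... | no _ = z≤n

  P-describes : Describes P InP
  P-describes = generated-describes (λ { g (i , g≡) → powE i , g≡ }) covered⇒InP InP⇒covered
    where
    covered⇒InP : ∀ w → MS.Covered PGen w → InP w
    covered⇒InP w (e , (i , e≡) , e∣w) with mono-injective e≡
    ... | refl = i , subst (_≤ w i) (powE-self i) (∣⇒≤S e∣w i)
    InP⇒covered : ∀ w → InP w → MS.Covered PGen w
    InP⇒covered w (i , le) = powE i , (i , refl) , ≤S⇒∣ (powE-≤ le)

  InP-up : ∀ {u v} → u ≤V v → InP u → InP v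
  InP-up u≤v (i , le) = i , ≤-trans le (u≤v i)

  -- the exponent c - w, truncated at 0
  co : ExpS → ExpS
  co w i = c i ∸ w i

  co-antitone : ∀ {u v} → u ≤V v → co v ≤V co u
  co-antitone u≤v i = ∸-monoʳ-≤ (c i) (u≤v i)

  co-co-≤ : ∀ w → co (co w) ≤V w
  co-co-≤ w i with ≤-total (w i) (c i)
  ... | inj₁ w≤c = ≤-reflexive (m∸[m∸n]≡n w≤c)
  ... | inj₂ c≤w = ≤-trans (m∸n≤m (c i) (c i ∸ w i)) c≤w

  DGen : S.Pol → Set (a ⊔ ℓ)
  DGen g = Σ ExpS λ e → IsCMon e × (¬ I (S.mono e)) × g ≡ S.mono (co e)

  InDual : ExpS → Set
  InDual w = ¬ InI (co w)

  InDual? : Decidable InDual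
  InDual? w = ¬? (InI? (co w))

  dual-describes : Describes (dual I) InDual
  dual-describes = generated-describes (λ { g (e , _ , _ , g≡) → co e , g≡ }) covered⇒InDual InDual⇒covered
    where
    -- if x^{co e} divides x^w then co w ≤ co (co e) ≤ e, so x^{co w} ∈ I would give x^e ∈ I
    covered⇒InDual : ∀ w → MS.Covered DGen w → InDual w
    covered⇒InDual w (e' , (e , _ , e∉I , e'≡) , e'∣w) InIco with mono-injective e'≡
    ... | refl = e∉I (Describes.contains I-describes e
                        (Any.map (λ g≤ i → ≤-trans (g≤ i) (≤-trans (co-antitone (∣⇒≤S e'∣w) i) (co-co-≤ e i))) InIco))
    InDual⇒covered : ∀ w → InDual w → MS.Covered DGen w
    InDual⇒covered w ¬InIco = co (co w) , (co w , (λ i → m∸n≤m (c i) (w i)) , co∉I , refl) , ≤S⇒∣ (co-co-≤ w)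
      where co∉I = λ Ico → describes-mono 1≉0 I-describes Ico ¬InIco

  J₁ J₂ : S.Pol → Set (a ⊔ ℓ)
  J₁ = S._∔_ I P
  J₂ = S._∔_ (dual I) P

  In₁ In₂ : ExpS → Set
  In₁ w = InI w ⊎ InP w
  In₂ w = InDual w ⊎ InP w

  In₁? : Decidable In₁
  In₁? w = InI? w ⊎-dec InP? w

  In₂? : Decidable In₂
  In₂? w = InDual? w ⊎-dec InP? w

  In₁-up : ∀ {u v} → u ≤V v → In₁ u → In₁ v
  In₁-up u≤v (inj₁ InIu) = inj₁ (Any.map (λ g≤ i → ≤-trans (g≤ i) (u≤v i)) InIu)
  In₁-up u≤v (inj₂ InPu) = inj₂ (InP-up u≤v InPu)

  In₂-up : ∀ {u v} → u ≤V v → In₂ u → In₂ v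
  In₂-up u≤v (inj₁ InDu) = inj₁ (λ InIcov → InDu (Any.map (λ g≤ i → ≤-trans (g≤ i) (co-antitone u≤v i)) InIcov))
  In₂-up u≤v (inj₂ InPu) = inj₂ (InP-up u≤v InPu)

  J₁-describes : Describes J₁ In₁
  J₁-describes = ∔-describes I-describes P-describes ideal-[] ideal-[]

  J₂-describes : Describes J₂ In₂
  J₂-describes = ∔-describes dual-describes P-describes ideal-[] ideal-[]

  J₁-J₂-overlap : ∀ {v u} → In₁ v → In₂ u → Σ (Fin n) λ i → c i < u i + v i
  J₁-J₂-overlap {v} {u} _ (inj₂ (i , le)) = i , ≤-trans le (m≤m+n (u i) (v i))
  J₁-J₂-overlap {v} {u} (inj₂ (i , le)) _ = i , ≤-trans le (m≤n+m (v i) (u i))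
  J₁-J₂-overlap {v} {u} (inj₁ InIv) (inj₁ ¬InIcou) = decidable-stable (any? (λ i → c i <? u i + v i)) λ none →
    ¬InIcou (Any.map (λ g≤ i → ≤-trans (g≤ i) (v≤cou none i)) InIv)
    where
    v≤cou : ¬ (Σ (Fin n) λ i → c i < u i + v i) → v ≤V co u
    v≤cou none i = m+n≤o⇒m≤o∸n (v i) (subst (_≤ c i) (+-comm (u i) (v i)) (≮⇒≥ (λ lt → none (i , lt))))

  _≤T_ : ExpT → ExpT → Set
  u ≤T v = ∀ i j → u i j ≤ v i j

  ≈T-isEquivalence : IsEquivalence _≈T_
  ≈T-isEquivalence = record
    { refl = λ _ _ → refl
    ; sym = λ u≈v i j → sym (u≈v i j)
    ; trans = λ u≈v v≈w i j → trans (u≈v i j) (v≈w i j)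
    }

  module MT = MonomialIdeals K _·T_ _≈T_ _≟T_ ≈T-isEquivalence

  ∣⇒≤T : ∀ {e t} → e MT.∣ t → e ≤T t
  ∣⇒≤T {e} (w , we≈t) i j = subst (e i j ≤_) (we≈t i j) (m≤n+m (e i j) (w i j))

  ≤T⇒∣ : ∀ {e t} → e ≤T t → e MT.∣ t
  ≤T⇒∣ {e} {t} e≤t = (λ i j → t i j ∸ e i j) , λ i j → m∸n+n≡m (e≤t i j)

  _∣T?_ : ∀ e t → Dec (e MT.∣ t)
  e ∣T? t with all? (λ i → all? (λ j → e i j ≤? t i j))
  ... | yes e≤t = yes (≤T⇒∣ e≤t)
  ... | no e≰t = no (λ e∣t → e≰t (∣⇒≤T e∣t))

  module MTP = MT.Products
    (λ u v i j → +-comm (u i j) (v i j))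
    (λ u v w i j → +-assoc (u i j) (v i j) (w i j))
    (λ w u≈v i j → cong (_+ w i j) (u≈v i j))
    (λ w uw≈vw i j → +-cancelʳ-≡ (w i j) _ _ (uw≈vw i j))
    _∣T?_

  indicator : ∀ {A : Set} → Dec A → ℕ
  indicator d = if does d then 1 else 0

  indicator-yes : ∀ {A : Set} (d : Dec A) → A → indicator d ≡ 1
  indicator-yes d x = cong (λ b → if b then 1 else 0) (dec-true d x)

  indicator-no : ∀ {A : Set} (d : Dec A) → ¬ A → indicator d ≡ 0
  indicator-no d ¬x = cong (λ b → if b then 1 else 0) (dec-false d ¬x)

  indicator-≤ : ∀ {A : Set} (d : Dec A) {m} → (A → 1 ≤ m) → indicator d ≤ m
  indicator-≤ (yes x) one≤m = one≤m x
  indicator-≤ (no _) _ = z≤n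

  polE-1 : ∀ {u i} j → toℕ j < u i → polE u i j ≡ 1
  polE-1 {u} {i} j = indicator-yes (toℕ j <? u i)

  polE-0 : ∀ {u i} j → ¬ toℕ j < u i → polE u i j ≡ 0
  polE-0 {u} {i} j = indicator-no (toℕ j <? u i)

  polE-≤ : ∀ {u t} → (∀ i j → toℕ j < u i → 1 ≤ t i j) → polE u ≤T t
  polE-≤ {u} below i j = indicator-≤ (toℕ j <? u i) (below i j)

  -- pol*(x^u) has the variables x_{i,j} with c_i < j + u_i, i.e. the top u_i of row i
  polStarE-1 : ∀ {u i} j → c i < toℕ j + u i → polStarE u i j ≡ 1
  polStarE-1 {u} {i} j = indicator-yes (c i <? toℕ j + u i)

  polStarE-≤ : ∀ {u t} → (∀ i j → c i < toℕ j + u i → 1 ≤ t i j) → polStarE u ≤T t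
  polStarE-≤ {u} below i j = indicator-≤ (c i <? toℕ j + u i) (below i j)

  FullRow : ExpT → Set
  FullRow t = Σ (Fin n) λ i → ∀ j → 1 ≤ t i j

  FullRow? : Decidable FullRow
  FullRow? t = any? (λ i → all? (λ j → 1 ≤? t i j))

  FullRow-resp : ∀ {u v} → u ≈T v → FullRow u → FullRow v
  FullRow-resp u≈v (i , full) = i , λ j → subst (1 ≤_) (u≈v i j) (full j)

  PolGen : ∀ {p} → (S.Pol → Set p) → T.Pol → Set (a ⊔ p)
  PolGen J g = Σ ExpS λ u → MinGen J u × g ≡ T.mono (polE u)

  PolStarGen : ∀ {p} → (S.Pol → Set p) → T.Pol → Set (a ⊔ p)
  PolStarGen J g = Σ ExpS λ u → MinGen J u × g ≡ T.mono (polStarE u)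

  pol-monomial : ∀ {p} (J : S.Pol → Set p) → MT.MonomialGens (PolGen J)
  pol-monomial J g (u , _ , g≡) = polE u , g≡

  pol*-monomial : ∀ {p} (J : S.Pol → Set p) → MT.MonomialGens (PolStarGen J)
  pol*-monomial J g (u , _ , g≡) = polStarE u , g≡

  -- a generator x^u of P has u_i ≥ c_i + 1 for some i, so pol(x^u) contains row i
  covered⇒FullRow : ∀ t → MT.Covered (PolGen P) t → FullRow t
  covered⇒FullRow t (e , (u , (Pu , _) , e≡) , e∣t) with mono-member P-describes InP? Pu | MT.mono-injective e≡
  ... | i , le | refl = i , λ j →
    subst (_≤ t i j) (polE-1 {u} j (≤-trans (toℕ<n j) le)) (∣⇒≤T e∣t i j)

  -- a minimal generator x^u below x_i^{c_i+1} only involves x_i, so pol(x^u) lies in row i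
  FullRow⇒covered : ∀ t → FullRow t → MT.Covered (PolGen P) t
  FullRow⇒covered t (i , full) with minimal-generator P-describes InP? InP-up (i , ≤-reflexive (sym (powE-self i)))
  ... | u , u≤pow , mg = polE u , (u , mg , refl) , ≤T⇒∣ (polE-≤ below)
    where
    below : ∀ k j → toℕ j < u k → 1 ≤ t k j
    below k j lt with powE-support {i} {k} (<-≤-trans (≤-trans (s≤s z≤n) lt) (u≤pow k))
    ... | refl = full j

  polP-describes : MT.Describes (pol P) FullRow
  polP-describes = MT.generated-describes (pol-monomial P) covered⇒FullRow FullRow⇒covered

  -- pol* J₂: a monomial t of S~ is a multiple of some pol*(x^u), x^u ∈ J₂, iff the vector of
  -- lengths of the top runs of the rows of t lies in J₂.

  TopRunAt : ExpT → (i : Fin n) → ℕ → Fin (suc (c i)) → Set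
  TopRunAt t i k j = c i < toℕ j + k → 1 ≤ t i j

  TopRun : ExpT → (i : Fin n) → ℕ → Set
  TopRun t i k = ∀ j → TopRunAt t i k j

  TopRunAt? : ∀ t i k → Decidable (TopRunAt t i k)
  TopRunAt? t i k j = (c i <? toℕ j + k) →-dec (1 ≤? t i j)

  TopRun? : ∀ t i → Decidable (TopRun t i)
  TopRun? t i k = all? (TopRunAt? t i k)

  module Top t i = Largest (TopRun t i) (TopRun? t i)

  topLen : ExpT → ExpS
  topLen t i = Top.largest t i (suc (c i))

  topLen-run : ∀ t i → TopRun t i (topLen t i)
  topLen-run t i = Top.largest-sat t i empty-run (suc (c i))
    where
    empty-run : TopRun t i 0
    empty-run j lt = ⊥-elim (<⇒≱ lt (subst (_≤ c i) (sym (+-identityʳ (toℕ j))) (≤-pred (toℕ<n j))))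

  topLen-max : ∀ t i {k} → k ≤ suc (c i) → TopRun t i k → k ≤ topLen t i
  topLen-max t i {k} k≤ run = Top.largest-max t i (suc (c i)) k k≤ run

  topLen-gap : ∀ t i → topLen t i ≤ c i → Σ (Fin (suc (c i))) λ j → t i j ≡ 0 × c i ∸ topLen t i ≤ toℕ j
  topLen-gap t i short with ¬∀⟶∃¬ (suc (c i)) (TopRunAt t i (suc (topLen t i))) (TopRunAt? t i (suc (topLen t i)))
                          (λ longer → 1+n≰n (topLen-max t i (s≤s short) longer))
  ... | j , ¬step = j , n<1⇒n≡0 (≰⇒> (λ one≤ → ¬step (λ _ → one≤))) , m≤n+o⇒m∸n≤o (c i) (topLen t i) above
    where
    in-run : c i < toℕ j + suc (topLen t i)
    in-run = decidable-stable (c i <? toℕ j + suc (topLen t i)) (λ out → ¬step (λ lt → ⊥-elim (out lt)))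
    above : c i ≤ topLen t i + toℕ j
    above = ≤-pred (subst (c i <_) (trans (+-suc (toℕ j) (topLen t i)) (cong suc (+-comm (toℕ j) (topLen t i)))) in-run)

  InPol* : ExpT → Set
  InPol* t = In₂ (topLen t)

  InPol*? : Decidable InPol*
  InPol*? t = In₂? (topLen t)

  InPol*-resp : ∀ {u v} → u ≈T v → InPol* u → InPol* v
  InPol*-resp {u} {v} u≈v = In₂-up λ i →
    topLen-max v i (Top.largest-≤ u i (suc (c i))) (λ j lt → subst (1 ≤_) (u≈v i j) (topLen-run u i j lt))

  -- a minimal generator x^u of J₂ below topLen t gives pol*(x^u) dividing t
  InPol*⇒covered : ∀ t → InPol* t → MT.Covered (PolStarGen J₂) t
  InPol*⇒covered t InPol*t with minimal-generator J₂-describes In₂? In₂-up InPol*t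
  ... | u , u≤top , mg = polStarE u , (u , mg , refl) , ≤T⇒∣ (polStarE-≤ λ i j lt →
    topLen-run t i j (≤-trans lt (+-monoʳ-≤ (toℕ j) (u≤top i))))

  -- pol*(J₂) ⊆ pol(P) : pol(J₁), since pol*(x^u) · pol(x^v) has a full row whenever
  -- x^u ∈ J₂ and x^v ∈ J₁.

  overlap-full-row : ∀ {u v} i → c i < u i + v i → ∀ j → 1 ≤ polStarE u i j + polE v i j
  overlap-full-row {u} {v} i lt j with toℕ j <? v i
  ... | yes j<v = ≤-trans (≤-reflexive (sym (polE-1 {v} j j<v))) (m≤n+m (polE v i j) (polStarE u i j))
  ... | no j≮v = ≤-trans (≤-reflexive (sym (polStarE-1 {u} j top))) (m≤m+n (polStarE u i j) (polE v i j))
    where top = ≤-trans lt (subst (u i + v i ≤_) (+-comm (u i) (toℕ j)) (+-monoʳ-≤ (u i) (≮⇒≥ j≮v)))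

  pol*J₂-times-polJ₁ : ∀ f → pol* J₂ f → ∀ l → pol J₁ l → pol P (f T.*P l)
  pol*J₂-times-polJ₁ f f∈ l l∈ =
    MT.support-member FullRow? FullRow-resp FullRow⇒covered (f T.*P l) λ t ¬full →
      MTP.product-supported (pol-monomial J₁) f (MT.generated-supported (pol*-monomial J₂) {f} f∈) l∈ t
        (λ w e w-covered e-gen we∣t → ¬full (full-row w e w-covered e-gen we∣t))
    where
    full-row : ∀ {t} w e → MT.Covered (PolStarGen J₂) w → PolGen J₁ (T.mono e) → (w ·T e) MT.∣ t → FullRow t
    full-row {t} w e (e' , (u , (J₂u , _) , e'≡) , e'∣w) (v , (J₁v , _) , e≡) we∣t
      with MT.mono-injective e'≡ | MT.mono-injective e≡
         | J₁-J₂-overlap (mono-member J₁-describes In₁? J₁v) (mono-member J₂-describes In₂? J₂u)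
    ... | refl | refl | i , lt = i , λ j → begin
      1                                ≤⟨ overlap-full-row {u} {v} i lt j ⟩
      polStarE u i j + polE v i j      ≤⟨ +-monoˡ-≤ (polE v i j) (∣⇒≤T e'∣w i j) ⟩
      w i j + polE v i j               ≤⟨ ∣⇒≤T we∣t i j ⟩
      t i j                            ∎
      where open ≤-Reasoning

  -- pol(P) : pol(J₁) ⊆ pol*(J₂): if f · pol(J₁) ⊆ pol(P), then f vanishes at each t outside pol*(J₂);
  -- take a minimal generator x^v of J₁ below co (topLen t), then t · pol(x^v) has no full row.

  no-full-row : ∀ t v → (∀ i → topLen t i ≤ c i) → v ≤V co (topLen t) → ¬ FullRow (t ·T polE v)
  no-full-row t v short v≤ (i , full) with topLen-gap t i (short i)
  ... | j , tij≡0 , gap≤j = 1+n≰n (≤-trans (full j) (≤-reflexive (cong₂ _+_ tij≡0 (polE-0 {v} j below))))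
    where below = λ j<v → <⇒≱ j<v (≤-trans (v≤ i) gap≤j)

  outside-pol* : ∀ t → ¬ InPol* t → InI (co (topLen t)) × (∀ i → topLen t i ≤ c i)
  outside-pol* t ¬InPol*t =
    decidable-stable (InI? (co (topLen t))) (¬InPol*t ∘ inj₁) ,
    λ i → ≤-pred (≰⇒> (λ long → ¬InPol*t (inj₂ (i , long))))

  colon-in-pol*J₂ : ∀ f → (∀ l → pol J₁ l → pol P (f T.*P l)) → pol* J₂ f
  colon-in-pol*J₂ f colon = MT.support-member InPol*? InPol*-resp InPol*⇒covered f vanishes
    where
    vanishes : ∀ t → ¬ InPol* t → T.coeff f t KR.≈ KR.0#
    vanishes t ¬InPol*t with outside-pol* t ¬InPol*t
    ... | InIco , short with minimal-generator J₁-describes In₁? In₁-up (inj₁ InIco)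
    ...   | v , v≤co , mg = KR.trans (KR.sym (MTP.coeff-*mono f (polE v) t))
            (MT.Describes.support polP-describes {f T.*P T.mono (polE v)} (colon _ polv∈)
              (t ·T polE v) (no-full-row t v short v≤co))
      where
      polv∈ : pol J₁ (T.mono (polE v))
      polv∈ = MT.ideal-term {e = polE v} (v , mg , refl) ((λ _ _ → 0) , λ _ _ → refl) KR.1#

lemma5p2 : ∀ {a ℓ : Level} (K : CommutativeRing a ℓ) → IsField K →
    (n : ℕ) (c : Fin n → ℕ) → (∀ i → 1 ≤ c i) →
    (gens : List (Fin n → ℕ)) → All (Setup.IsCMon K n c) gens →
    let open Setup K n c
        I = idealOf gens
    in T._≐_ (T._∶_ (pol P) (pol (S._∔_ I P))) (pol* (S._∔_ (dual I) P))
lemma5p2 K isField n c _ gens _ f =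
  colon-in-pol*J₂ f , λ f∈pol* l l∈polJ₁ → pol*J₂-times-polJ₁ f f∈pol* l l∈polJ₁
  where open Lemma5p2 K isField n c gens
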